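{- Let $q$ be a prime power and $r,t\ge 2$ integers with $t<q$, $n=\frac{q^{rt}-1}{q^t-1}$. Let $\omega$ be a generator of a Singer cycle of $\mathrm{PG}(r-1,q^t)$ and let $\hat\omega\in\mathrm{GL}(r^t,q)$ be a matrix inducing the collineation of the ambient space $\mathrm{PG}(r^t-1,q)$ which maps $P^\alpha$ to $(\omega P)^\alpha$ for all points $P$. Order the columns $H_0,\ldots,H_{n-1}$ of the parity-check matrix of $\mathcal C_{r,t}$ so that $H_{i+1}=\hat\omega(H_i)$ for $i=0,\ldots,n-2$. Then $\mathcal C_{r,t}$ is constacyclic.
   Context: For a point $P=\langle (x_0,\ldots,x_{r-1})\rangle$ of $\mathrm{PG}(r-1,q^t)$, $P^{\alpha}$ is the point of $\mathrm{PG}(r^t-1,q^t)$ whose coordinates, indexed by the functions $f:\{0,\ldots,t-1\}\to\{0,\ldots,r-1\}$, are $y_f=\prod_{i=0}^{t-1}x_{f(i)}^{q^i}$; the image of $\alpha$ is the variety $\mathcal V_{r,t}$, which lies in the subgeometry $\Omega\cong\mathrm{PG}(r^t-1,q)$ of points fixed by $(y_f)_f\mapsto(y_{f\circ\tau}^q)_f$, $\tau(i)=i+1\bmod t$; fixing a collineation mapping $\Omega$ to the canonical subgeometry, each point of $\mathcal V_{r,t}$ gets a coordinate vector in $\mathbb F_q^{r^t}$. The code $\mathcal C_{r,t}=\{w\in\mathbb F_q^n:Hw^T=0\}$ where $H$ is the $r^t\times n$ matrix over $\mathbb F_q$ whose columns are coordinate vectors of the $n$ points of $\mathcal V_{r,t}$,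 each once. A Singer cycle of $\mathrm{PG}(r-1,q^t)$ is a cyclic group of linear collineations acting regularly on its points. A code $\mathcal C\subseteq\mathbb F_q^n$ is constacyclic if there is $\beta\in\mathbb F_q$ such that $(w_0,\ldots,w_{n-1})\in\mathcal C$ implies $(\beta w_{n-1},w_0,\ldots,w_{n-2})\in\mathcal C$. -}

module Defs where

open import Data.Nat as ℕ using (ℕ; zero; suc)
open import Data.Fin using (Fin; zero; suc; fromℕ; inject₁)
open import Data.Vec using (Vec; []; _∷_; _∷ʳ_; lookup)
open import Data.Product using (Σ; ∃; _×_; _,_)
open import Data.Unit using (⊤)
open import Relation.Nullary using (¬_)
open import Relation.Binary.PropositionalEquality using (_≡_)
open import Algebra.Structures using (IsCommutativeRing)
open import Function.Bundles using (_↔_)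

record FiniteField (Q : ℕ) : Set₁ where
  infixl 6 _+_
  infixl 7 _*_
  field
    Carrier : Set
    _+_ _*_ : Carrier → Carrier → Carrier
    -_ : Carrier → Carrier
    0# 1# : Carrier
    isCommutativeRing : IsCommutativeRing _≡_ _+_ _*_ -_ 0# 1#
    0≢1 : ¬ (0# ≡ 1#)
    inverse : ∀ x → ¬ (x ≡ 0#) → ∃ λ y → x * y ≡ 1#
    enumeration : Carrier ↔ Fin Q

-- Cyclic rotation of a word:  (rotate f) i = f (i+1 mod t),  i.e. f ∘ τ.

rotate : ∀ {A : Set} {t} → Vec A t → Vec A t
rotate [] = []
rotate (x ∷ xs) = xs ∷ʳ x

module FF {Q : ℕ} (F : FiniteField Q) where
  open FiniteField F

  _^ᶠ_ : Carrier → ℕ → Carrier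
  x ^ᶠ zero = 1#
  x ^ᶠ suc n = x * (x ^ᶠ n)

  InFq : ℕ → Carrier → Set
  InFq q x = x ^ᶠ q ≡ x

  sumFin : ∀ {m} → (Fin m → Carrier) → Carrier
  sumFin {zero} g = 0#
  sumFin {suc m} g = g zero + sumFin (λ i → g (suc i))

  prodFin : ∀ {m} → (Fin m → Carrier) → Carrier
  prodFin {zero} g = 1#
  prodFin {suc m} g = g zero * prodFin (λ i → g (suc i))

  -- sum over all words f : {0..t-1} → {0..r-1}  (the r^t coordinates)
  sumWords : ∀ t r → (Vec (Fin r) t → Carrier) → Carrier
  sumWords zero r g = g []
  sumWords (suc t) r g = sumFin (λ j → sumWords t r (λ f → g (j ∷ f)))

  Nonzero : {I : Set} → (I → Carrier) → Set
  Nonzero {I} v = Σ I λ i → ¬ (v i ≡ 0#)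

  _∼_ : {I : Set} → (I → Carrier) → (I → Carrier) → Set
  u ∼ v = Σ Carrier λ c → ¬ (c ≡ 0#) × (∀ i → u i ≡ c * v i)

  apply : {I : Set} → ((I → Carrier) → Carrier) →
          (I → I → Carrier) → (I → Carrier) → (I → Carrier)
  apply sumI M y i = sumI (λ j → M i j * y j)

  Invertible : {I : Set} → ((I → Carrier) → Carrier) → (I → I → Carrier) → Set
  Invertible {I} sumI M = Σ (I → I → Carrier) λ N →
    (∀ y i → apply sumI N (apply sumI M y) i ≡ y i) ×
    (∀ y i → apply sumI M (apply sumI N y) i ≡ y i)

  iter : ∀ {A : Set} → (A → A) → ℕ → A → A
  iter g zero a = a
  iter g (suc k) a = g (iter g k a)

  -- ω generates a Singer cycle of PG(r-1, Q): the cyclic group generated by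
  -- the collineation induced by ω has order n and acts regularly on points.
  SingerGenerator : ∀ r (n : ℕ) → (Fin r → Fin r → Carrier) → Set
  SingerGenerator r n ω =
    Invertible sumFin ω ×
    (∀ P → Nonzero P → iter (apply sumFin ω) n P ∼ P) ×
    (∀ P P′ → Nonzero P → Nonzero P′ →
       Σ (Fin n) λ k → iter (apply sumFin ω) (Data.Fin.toℕ k) P ∼ P′) ×
    (∀ P (k : Fin n) → Nonzero P →
       iter (apply sumFin ω) (Data.Fin.toℕ k) P ∼ P → Data.Fin.toℕ k ≡ 0)

  alpha : ∀ (q t r : ℕ) → (Fin r → Carrier) → Vec (Fin r) t → Carrier
  alpha q t r x f = prodFin (λ (i : Fin t) →
                      x (lookup f i) ^ᶠ (q ℕ.^ Data.Fin.toℕ i))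

  -- the semilinear map (y_f)_f ↦ (y_{f∘τ}^q)_f  whose fixed points form Ω
  sigma : ∀ (q t r : ℕ) → (Vec (Fin r) t → Carrier) → Vec (Fin r) t → Carrier
  sigma q t r y f = y (rotate f) ^ᶠ q

  InΩ : ∀ (q t r : ℕ) → (Vec (Fin r) t → Carrier) → Set
  InΩ q t r y = Nonzero y × (sigma q t r y ∼ y)

  InCanonical : ∀ (q t r : ℕ) → (Vec (Fin r) t → Carrier) → Set
  InCanonical q t r y = Σ (Vec (Fin r) t → Carrier) λ v →
    (∀ f → InFq q (v f)) × y ∼ v

  InCode : ∀ (q t r n : ℕ) → (Fin n → Vec (Fin r) t → Carrier) →
           (Fin n → Carrier) → Set
  InCode q t r n H w = (∀ i → InFq q (w i)) ×
    (∀ f → sumFin (λ i → w i * H i f) ≡ 0#)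

  shift : ∀ {n} → Carrier → (Fin n → Carrier) → Fin n → Carrier
  shift {zero} β w = w
  shift {suc m} β w zero = β * w (fromℕ m)
  shift {suc m} β w (suc i) = w (inject₁ i)

  Constacyclic : ∀ (q n : ℕ) → ((Fin n → Carrier) → Set) → Set
  Constacyclic q n C = Σ Carrier λ β → InFq q β ×
    (∀ w → C w → C (shift β w))

-- The map ω̂ sends points of V_{r,t} to points of V_{r,t}, so ω̂ H_{n-1} is proportional to some
-- column H_k.  Since ω̂ is injective on points and H_k = ω̂ H_{k-1} for k > 0, the distinct
-- columns force k = 0, i.e. ω̂ H_{n-1} = β H_0.  Both sides have entries in F_q, hence so does β;
-- this uses that x ↦ x^q is additive, q being a power of the characteristic of F_{q^t}.  For a
-- codeword w the shifted word (β w_{n-1}, w_0, …, w_{n-2}) then satisfies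
--   β w_{n-1} H_0 + Σ_{i<n-1} w_i H_{i+1} = Σ_i w_i ω̂ H_i = ω̂ (Σ_i w_i H_i) = 0.

module Submission where

open import Algebra.Bundles using (CommutativeRing)
import Algebra.Properties.CommutativeSemigroup as CommutativeSemigroupProperties
import Algebra.Properties.CommutativeSemiring.Binomial as Binomial
import Algebra.Properties.CommutativeSemiring.Exp as Exp
import Algebra.Properties.Group as GroupProperties
import Algebra.Properties.Semiring.Mult as Mult
import Algebra.Properties.Semiring.Sum as Sum
open import Data.Empty using (⊥-elim)
open import Data.Fin as Fin using (Fin; zero; suc; toℕ; fromℕ; inject₁)
import Data.Fin.Properties as Finₚ
open import Data.Nat as ℕ using (ℕ; zero; suc; _∸_; _<_; _!; z≤n; s≤s)
open import Data.Nat.Properties as ℕₚ using (_!*_!≢0)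
open import Data.Nat.Combinatorics using (_C_; nCn≡1; k![n∸k]!∣n!; nCk≡n!/k![n-k]!)
open import Data.Nat.Divisibility using (_∣_; _∤_; divides; ∣⇒≤; ∣1⇒≡1; m∣m*n)
open import Data.Nat.DivMod using (m/n*n≡m)
open import Data.Nat.Primality using (Prime; euclidsLemma; prime⇒nonTrivial; prime⇒nonZero)
open import Data.Product using (∃; _×_; _,_)
open import Data.Sum using (inj₁; inj₂)
open import Data.Vec using (Vec; []; _∷_)
open import Function.Bundles using (Inverse; _↔_; mk↔ₛ′)
open import Function.Properties.Inverse using (↔-sym; ↔-trans; ↔⇒↣)
open import Relation.Binary.PropositionalEquality
open import Relation.Nullary using (¬_; Dec; yes; no; ¬?)
open import Relation.Nullary.Decidable using (map′; via-injection; decidable-stable)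

open import Defs

-- Binomial coefficients modulo a prime

n∣n! : ∀ n → .{{ℕ.NonZero n}} → n ∣ n !
n∣n! (suc n) = m∣m*n (n !)

module _ {p} (p-prime : Prime p) where

  private
    instance
      p≢0 : ℕ.NonZero p
      p≢0 = prime⇒nonZero p-prime

  prime∤m! : ∀ {m} → m < p → p ∤ m !
  prime∤m! {zero} _ p∣1 =
    ℕₚ.<⇒≢ (ℕ.nonTrivial⇒n>1 p {{prime⇒nonTrivial p-prime}}) (sym (∣1⇒≡1 p∣1))
  prime∤m! {suc m} m<p p∣m! with euclidsLemma (suc m) (m !) p-prime p∣m!
  ... | inj₁ p∣1+m = ℕₚ.<⇒≱ m<p (∣⇒≤ p∣1+m)
  ... | inj₂ p∣m!  = prime∤m! (ℕₚ.<-trans (ℕₚ.n<1+n m) m<p) p∣m!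

  prime∣pCk : ∀ {k} → 0 < k → k < p → p ∣ p C k
  prime∣pCk {k} 0<k k<p with euclidsLemma (p C k) (k ! ℕ.* (p ∸ k) !) p-prime p∣pCk*k!*[p∸k]!
    where
    pCk*k!*[p∸k]!≡p! : (p C k) ℕ.* (k ! ℕ.* (p ∸ k) !) ≡ p !
    pCk*k!*[p∸k]!≡p! = trans (cong (ℕ._* (k ! ℕ.* (p ∸ k) !)) (nCk≡n!/k![n-k]! (ℕₚ.<⇒≤ k<p)))
                             (m/n*n≡m {{k !* (p ∸ k) !≢0}} (k![n∸k]!∣n! (ℕₚ.<⇒≤ k<p)))
    p∣pCk*k!*[p∸k]! : p ∣ (p C k) ℕ.* (k ! ℕ.* (p ∸ k) !)
    p∣pCk*k!*[p∸k]! = subst (p ∣_) (sym pCk*k!*[p∸k]!≡p!) (n∣n! p)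
  ... | inj₁ p∣pCk = p∣pCk
  ... | inj₂ p∣k!*[p∸k]! with euclidsLemma (k !) ((p ∸ k) !) p-prime p∣k!*[p∸k]!
  ...   | inj₁ p∣k!     = ⊥-elim (prime∤m! k<p p∣k!)
  ...   | inj₂ p∣[p∸k]! = ⊥-elim (prime∤m! (ℕₚ.∸-monoʳ-< 0<k (ℕₚ.<⇒≤ k<p)) p∣[p∸k]!)

module FieldProperties {Q : ℕ} (F : FiniteField Q) where

  open FiniteField F
  open FF F

  commutativeRing : CommutativeRing _ _
  commutativeRing = record { isCommutativeRing = isCommutativeRing }

  open CommutativeRing commutativeRing
    using ( +-identityˡ; +-identityʳ; +-comm; *-identityˡ; *-identityʳ; *-assoc; *-comm; zeroˡ; zeroʳ
          ; +-group; semiring; commutativeSemiring; *-commutativeSemigroup)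
  open CommutativeSemigroupProperties *-commutativeSemigroup using (x∙yz≈y∙xz; xy∙z≈y∙xz)
  open GroupProperties +-group using (identityʳ-unique; //-rightDividesˡ; //-rightDividesʳ)
  open Exp commutativeSemiring public using (_^_)
  open Exp commutativeSemiring using (^-distrib-*; ^-assocʳ)
  open Mult semiring using (×-homo-1; ×1-homo-*; ×-assoc-*) renaming (_×_ to _·_)
  open Sum semiring
    using ( sum; sum-cong-≗; ∑-distrib-+; ∑-comm; *-distribˡ-sum; sum-init-last
          ; sum-replicate; sum-replicate-zero; sum-permute)
  open ≡-Reasoning

  x*y≡0⇒y≡0 : ∀ {x y} → ¬ x ≡ 0# → x * y ≡ 0# → y ≡ 0#
  x*y≡0⇒y≡0 {x} {y} x≢0 xy≡0 with inverse x x≢0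
  ... | x⁻¹ , xx⁻¹≡1 = begin
    y              ≡⟨ sym (*-identityˡ y) ⟩
    1# * y         ≡⟨ cong (_* y) (sym xx⁻¹≡1) ⟩
    x * x⁻¹ * y    ≡⟨ xy∙z≈y∙xz x x⁻¹ y ⟩
    x⁻¹ * (x * y)  ≡⟨ cong (x⁻¹ *_) xy≡0 ⟩
    x⁻¹ * 0#       ≡⟨ zeroʳ x⁻¹ ⟩
    0#             ∎

  *-≢0 : ∀ {x y} → ¬ x ≡ 0# → ¬ y ≡ 0# → ¬ x * y ≡ 0#
  *-≢0 x≢0 y≢0 xy≡0 = y≢0 (x*y≡0⇒y≡0 x≢0 xy≡0)

  *-cancelʳ-≢0 : ∀ {x y z} → ¬ z ≡ 0# → x * z ≡ y * z → x ≡ y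
  *-cancelʳ-≢0 {x} {y} {z} z≢0 xz≡yz with inverse z z≢0
  ... | z⁻¹ , zz⁻¹≡1 = begin
    x              ≡⟨ sym (*-identityʳ x) ⟩
    x * 1#         ≡⟨ cong (x *_) (sym zz⁻¹≡1) ⟩
    x * (z * z⁻¹)  ≡⟨ sym (*-assoc x z z⁻¹) ⟩
    x * z * z⁻¹    ≡⟨ cong (_* z⁻¹) xz≡yz ⟩
    y * z * z⁻¹    ≡⟨ *-assoc y z z⁻¹ ⟩
    y * (z * z⁻¹)  ≡⟨ cong (y *_) zz⁻¹≡1 ⟩
    y * 1#         ≡⟨ *-identityʳ y ⟩
    y              ∎

  _≟0 : ∀ x → Dec (x ≡ 0#)
  x ≟0 = via-injection (↔⇒↣ enumeration) Fin._≟_ x 0#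

  ¬nonzero⇒zero : ∀ {I : Set} {v : I → Carrier} → ¬ Nonzero v → ∀ i → v i ≡ 0#
  ¬nonzero⇒zero {v = v} ¬nz i = decidable-stable (v i ≟0) (λ vᵢ≢0 → ¬nz (i , vᵢ≢0))

  nonzero?-Fin : ∀ {m} (v : Fin m → Carrier) → Dec (Nonzero v)
  nonzero?-Fin v = Finₚ.any? (λ i → ¬? (v i ≟0))

  nonzero?-Words : ∀ t r (v : Vec (Fin r) t → Carrier) → Dec (Nonzero v)
  nonzero?-Words zero r v = map′ ([] ,_) (λ { ([] , v≢0) → v≢0 }) (¬? (v [] ≟0))
  nonzero?-Words (suc t) r v =
    map′ (λ { (j , f , v≢0) → j ∷ f , v≢0 }) (λ { (j ∷ f , v≢0) → j , f , v≢0 })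
         (Finₚ.any? (λ j → nonzero?-Words t r (λ f → v (j ∷ f))))

  ^ᶠ≡^ : ∀ x n → x ^ᶠ n ≡ x ^ n
  ^ᶠ≡^ x zero    = refl
  ^ᶠ≡^ x (suc n) = cong (x *_) (^ᶠ≡^ x n)

  ^ᶠ-distrib-* : ∀ x y n → (x * y) ^ᶠ n ≡ x ^ᶠ n * y ^ᶠ n
  ^ᶠ-distrib-* x y n = begin
    (x * y) ^ᶠ n     ≡⟨ ^ᶠ≡^ (x * y) n ⟩
    (x * y) ^ n      ≡⟨ ^-distrib-* x y n ⟩
    x ^ n * y ^ n    ≡⟨ sym (cong₂ _*_ (^ᶠ≡^ x n) (^ᶠ≡^ y n)) ⟩
    x ^ᶠ n * y ^ᶠ n  ∎

  x^n≡0⇒x≡0 : ∀ x n → x ^ᶠ n ≡ 0# → x ≡ 0#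
  x^n≡0⇒x≡0 x zero 1≡0 = ⊥-elim (0≢1 (sym 1≡0))
  x^n≡0⇒x≡0 x (suc n) xⁿ⁺¹≡0 with x ≟0
  ... | yes x≡0 = x≡0
  ... | no  x≢0 = x^n≡0⇒x≡0 x n (x*y≡0⇒y≡0 x≢0 xⁿ⁺¹≡0)

  InFq-1 : ∀ q → InFq q 1#
  InFq-1 zero    = refl
  InFq-1 (suc q) = trans (*-identityˡ _) (InFq-1 q)

  InFq-* : ∀ {q x y} → InFq q x → InFq q y → InFq q (x * y)
  InFq-* {q} {x} {y} x∈Fq y∈Fq = trans (^ᶠ-distrib-* x y q) (cong₂ _*_ x∈Fq y∈Fq)

  InFq-ratio : ∀ {q x y c} → x ≡ c * y → ¬ y ≡ 0# → InFq q x → InFq q y → InFq q c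
  InFq-ratio {q} {x} {y} {c} x≡cy y≢0 x∈Fq y∈Fq = *-cancelʳ-≢0 y≢0 (begin
    c ^ᶠ q * y         ≡⟨ cong (c ^ᶠ q *_) (sym y∈Fq) ⟩
    c ^ᶠ q * y ^ᶠ q    ≡⟨ sym (^ᶠ-distrib-* c y q) ⟩
    (c * y) ^ᶠ q       ≡⟨ cong (_^ᶠ q) (sym x≡cy) ⟩
    x ^ᶠ q             ≡⟨ x∈Fq ⟩
    x                  ≡⟨ x≡cy ⟩
    c * y              ∎)

  -- Characteristic and the Frobenius map

  -- Σ x = Σ (x + 1), as x ↦ x + 1 permutes the field.
  Q·1≡0 : Q · 1# ≡ 0#
  Q·1≡0 = identityʳ-unique S (Q · 1#) (begin
    S + Q · 1#                           ≡⟨ cong (S +_) (sym (sum-replicate Q)) ⟩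
    S + sum {Q} (λ _ → 1#)               ≡⟨ sym (∑-distrib-+ from (λ _ → 1#)) ⟩
    sum (λ i → from i + 1#)              ≡⟨ sum-cong-≗ (λ i → sym (strictlyInverseʳ (from i + 1#))) ⟩
    sum (λ i → from (to (from i + 1#)))  ≡⟨ sym (sum-permute from π) ⟩
    S                                    ∎)
    where
    open Inverse enumeration
    S = sum from
    +1 : Carrier ↔ Carrier
    +1 = mk↔ₛ′ (_+ 1#) (_+ - 1#) (//-rightDividesˡ 1#) (//-rightDividesʳ 1#)
    π : Fin Q ↔ Fin Q
    π = ↔-trans (↔-sym enumeration) (↔-trans +1 enumeration)

  ·1-^ : ∀ n k → (n ℕ.^ k) · 1# ≡ (n · 1#) ^ᶠ k
  ·1-^ n zero    = +-identityʳ 1#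
  ·1-^ n (suc k) = trans (×1-homo-* n (n ℕ.^ k)) (cong ((n · 1#) *_) (·1-^ n k))

  Q≡pᵏ⇒p·1≡0 : ∀ {p k} → Q ≡ p ℕ.^ k → p · 1# ≡ 0#
  Q≡pᵏ⇒p·1≡0 {p} {k} Q≡pᵏ =
    x^n≡0⇒x≡0 (p · 1#) k (trans (sym (·1-^ p k)) (trans (cong (_· 1#) (sym Q≡pᵏ)) Q·1≡0))

  n·1≡0⇒n·x≡0 : ∀ {n} x → n · 1# ≡ 0# → n · x ≡ 0#
  n·1≡0⇒n·x≡0 {n} x n·1≡0 = begin
    n · x         ≡⟨ cong (n ·_) (sym (*-identityˡ x)) ⟩
    n · (1# * x)  ≡⟨ sym (×-assoc-* n 1# x) ⟩
    n · 1# * x    ≡⟨ cong (_* x) n·1≡0 ⟩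
    0# * x        ≡⟨ zeroˡ x ⟩
    0#            ∎

  p∣n⇒n·x≡0 : ∀ {p n} x → p · 1# ≡ 0# → p ∣ n → n · x ≡ 0#
  p∣n⇒n·x≡0 {p} x p·1≡0 (divides d refl) = n·1≡0⇒n·x≡0 {d ℕ.* p} x (begin
    (d ℕ.* p) · 1#       ≡⟨ ×1-homo-* d p ⟩
    d · 1# * (p · 1#)    ≡⟨ cong (d · 1# *_) p·1≡0 ⟩
    d · 1# * 0#          ≡⟨ zeroʳ _ ⟩
    0#                   ∎)

  -- In the binomial expansion of (x + y) ^ p only the two outer terms survive.
  frobenius : ∀ {p} → Prime p → p · 1# ≡ 0# → ∀ x y → (x + y) ^ p ≡ x ^ p + y ^ p
  frobenius {zero} p-prime = ⊥-elim (ℕₚ.n≮0 (ℕ.nonTrivial⇒n>1 0 {{prime⇒nonTrivial p-prime}}))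
  frobenius {suc p} p-prime p·1≡0 x y = begin
    (x + y) ^ suc p                            ≡⟨ theorem (suc p) x y ⟩
    T zero + sum (λ i → T (suc i))             ≡⟨ cong (T zero +_) (sum-init-last (λ i → T (suc i))) ⟩
    T zero + (sum (λ i → T (suc (inject₁ i))) + T (suc (fromℕ p)))
      ≡⟨ cong₂ (λ a b → a + (b + T (suc (fromℕ p)))) first-term middle-terms-vanish ⟩
    y ^ suc p + (0# + T (suc (fromℕ p)))       ≡⟨ cong (y ^ suc p +_) (+-identityˡ _) ⟩
    y ^ suc p + T (suc (fromℕ p))              ≡⟨ cong (y ^ suc p +_) last-term ⟩
    y ^ suc p + x ^ suc p                      ≡⟨ +-comm _ _ ⟩
    x ^ suc p + y ^ suc p                      ∎
    where
    open Binomial commutativeSemiring using (theorem; binomialTerm)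
    T = binomialTerm x y (suc p)

    first-term : T zero ≡ y ^ suc p
    first-term = trans (×-homo-1 _) (*-identityˡ _)

    middle-term-vanishes : ∀ i → T (suc (inject₁ i)) ≡ 0#
    middle-term-vanishes i = p∣n⇒n·x≡0 _ p·1≡0 (prime∣pCk p-prime (s≤s z≤n) (s≤s (Finₚ.inject₁ℕ< i)))

    middle-terms-vanish : sum (λ i → T (suc (inject₁ i))) ≡ 0#
    middle-terms-vanish = trans (sum-cong-≗ middle-term-vanishes) (sum-replicate-zero p)

    last-term : T (suc (fromℕ p)) ≡ x ^ suc p
    last-term = begin
      T (suc (fromℕ p))
        ≡⟨ cong (λ k → (suc p C k) · (x ^ k * y ^ (suc p ∸ k))) (cong suc (Finₚ.toℕ-fromℕ p)) ⟩
      (suc p C suc p) · (x ^ suc p * y ^ (p ∸ p))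
        ≡⟨ cong (_· (x ^ suc p * y ^ (p ∸ p))) (nCn≡1 (suc p)) ⟩
      1 · (x ^ suc p * y ^ (p ∸ p))   ≡⟨ ×-homo-1 _ ⟩
      x ^ suc p * y ^ (p ∸ p)         ≡⟨ cong (λ k → x ^ suc p * y ^ k) (ℕₚ.n∸n≡0 p) ⟩
      x ^ suc p * 1#                  ≡⟨ *-identityʳ _ ⟩
      x ^ suc p                       ∎

  frobenius-^ : ∀ {p} → Prime p → p · 1# ≡ 0# →
                ∀ e x y → (x + y) ^ (p ℕ.^ e) ≡ x ^ (p ℕ.^ e) + y ^ (p ℕ.^ e)
  frobenius-^ p-prime p·1≡0 zero x y =
    trans (*-identityʳ _) (sym (cong₂ _+_ (*-identityʳ x) (*-identityʳ y)))
  frobenius-^ {p} p-prime p·1≡0 (suc e) x y = begin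
    (x + y) ^ (p ℕ.* pᵉ)                ≡⟨ sym (^-assocʳ (x + y) p pᵉ) ⟩
    ((x + y) ^ p) ^ pᵉ                  ≡⟨ cong (_^ pᵉ) (frobenius p-prime p·1≡0 x y) ⟩
    (x ^ p + y ^ p) ^ pᵉ                ≡⟨ frobenius-^ p-prime p·1≡0 e (x ^ p) (y ^ p) ⟩
    (x ^ p) ^ pᵉ + (y ^ p) ^ pᵉ         ≡⟨ cong₂ _+_ (^-assocʳ x p pᵉ) (^-assocʳ y p pᵉ) ⟩
    x ^ (p ℕ.* pᵉ) + y ^ (p ℕ.* pᵉ)     ∎
    where pᵉ = p ℕ.^ e

  frobenius-q : ∀ {p e q t} → Prime p → q ≡ p ℕ.^ e → Q ≡ q ℕ.^ t →
                ∀ x y → (x + y) ^ q ≡ x ^ q + y ^ q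
  frobenius-q {p} {e} {q} {t} p-prime refl Q≡qᵗ =
    frobenius-^ p-prime (Q≡pᵏ⇒p·1≡0 {p} {e ℕ.* t} (trans Q≡qᵗ (ℕₚ.^-*-assoc p e t))) e

  sumFin≡sum : ∀ {m} (g : Fin m → Carrier) → sumFin g ≡ sum g
  sumFin≡sum {zero}  g = refl
  sumFin≡sum {suc m} g = cong (g zero +_) (sumFin≡sum (λ i → g (suc i)))

  sumFin-cong : ∀ {m} {g h : Fin m → Carrier} → g ≗ h → sumFin g ≡ sumFin h
  sumFin-cong {g = g} {h} g≗h =
    trans (sumFin≡sum g) (trans (sum-cong-≗ g≗h) (sym (sumFin≡sum h)))

  *-distribˡ-sumFin : ∀ {m} c (g : Fin m → Carrier) → c * sumFin g ≡ sumFin (λ i → c * g i)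
  *-distribˡ-sumFin {m} c g = begin
    c * sumFin g             ≡⟨ cong (c *_) (sumFin≡sum g) ⟩
    c * sum g                ≡⟨ *-distribˡ-sum c g ⟩
    sum (λ i → c * g i)      ≡⟨ sym (sumFin≡sum {m} _) ⟩
    sumFin (λ i → c * g i)   ∎

  sumFin-init-last : ∀ {m} (g : Fin (suc m) → Carrier) →
                     sumFin g ≡ sumFin (λ i → g (inject₁ i)) + g (fromℕ m)
  sumFin-init-last {m} g = begin
    sumFin g                                   ≡⟨ sumFin≡sum g ⟩
    sum g                                      ≡⟨ sum-init-last g ⟩
    sum (λ i → g (inject₁ i)) + g (fromℕ _)    ≡⟨ cong (_+ g (fromℕ _)) (sym (sumFin≡sum {m} _)) ⟩
    sumFin (λ i → g (inject₁ i)) + g (fromℕ _) ∎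

  sumFin-comm : ∀ {m n} (g : Fin m → Fin n → Carrier) →
                sumFin (λ i → sumFin (g i)) ≡ sumFin (λ j → sumFin (λ i → g i j))
  sumFin-comm {m} {n} g = begin
    sumFin (λ i → sumFin (g i))              ≡⟨ sumFin-cong {m} (λ i → sumFin≡sum (g i)) ⟩
    sumFin (λ i → sum (g i))                 ≡⟨ sumFin≡sum {m} _ ⟩
    sum (λ i → sum (g i))                    ≡⟨ ∑-comm g ⟩
    sum (λ j → sum (λ i → g i j))            ≡⟨ sym (sumFin≡sum {n} _) ⟩
    sumFin (λ j → sum (λ i → g i j))         ≡⟨ sumFin-cong {n} (λ j → sym (sumFin≡sum {m} _)) ⟩
    sumFin (λ j → sumFin (λ i → g i j))      ∎

  sumWords-cong : ∀ t r {g h : Vec (Fin r) t → Carrier} → g ≗ h → sumWords t r g ≡ sumWords t r h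
  sumWords-cong zero    r g≗h = g≗h []
  sumWords-cong (suc t) r g≗h = sumFin-cong {r} (λ j → sumWords-cong t r (λ f → g≗h (j ∷ f)))

  *-distribˡ-sumWords : ∀ t r c (g : Vec (Fin r) t → Carrier) →
                        c * sumWords t r g ≡ sumWords t r (λ f → c * g f)
  *-distribˡ-sumWords zero    r c g = refl
  *-distribˡ-sumWords (suc t) r c g =
    trans (*-distribˡ-sumFin {r} c _)
          (sumFin-cong {r} (λ j → *-distribˡ-sumWords t r c (λ f → g (j ∷ f))))

  sumFin-sumWords-comm : ∀ {m} t r (g : Fin m → Vec (Fin r) t → Carrier) →
    sumFin (λ i → sumWords t r (g i)) ≡ sumWords t r (λ f → sumFin (λ i → g i f))
  sumFin-sumWords-comm zero    r g = refl
  sumFin-sumWords-comm {m} (suc t) r g =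
    trans (sumFin-comm {m} {r} (λ i j → sumWords t r (λ f → g i (j ∷ f))))
          (sumFin-cong {r} (λ j → sumFin-sumWords-comm t r (λ i f → g i (j ∷ f))))

  apply-sumFin : ∀ {m} t r (M : Vec (Fin r) t → Vec (Fin r) t → Carrier)
                 (w : Fin m → Carrier) (u : Fin m → Vec (Fin r) t → Carrier) →
                 apply (sumWords t r) M (λ g → sumFin (λ i → w i * u i g))
                   ≗ (λ f → sumFin (λ i → w i * apply (sumWords t r) M (u i) f))
  apply-sumFin {m} t r M w u f = begin
    sumWords t r (λ g → M f g * sumFin (λ i → w i * u i g))
      ≡⟨ sumWords-cong t r (λ g → *-distribˡ-sumFin {m} (M f g) _) ⟩
    sumWords t r (λ g → sumFin (λ i → M f g * (w i * u i g)))
      ≡⟨ sumWords-cong t r (λ g → sumFin-cong {m} (λ i → x∙yz≈y∙xz (M f g) (w i) (u i g))) ⟩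
    sumWords t r (λ g → sumFin (λ i → w i * (M f g * u i g)))
      ≡⟨ sym (sumFin-sumWords-comm {m} t r _) ⟩
    sumFin (λ i → sumWords t r (λ g → w i * (M f g * u i g)))
      ≡⟨ sumFin-cong {m} (λ i → sym (*-distribˡ-sumWords t r (w i) _)) ⟩
    sumFin (λ i → w i * sumWords t r (λ g → M f g * u i g))
      ∎

  ≗⇒∼ : ∀ {I : Set} {u v : I → Carrier} → u ≗ v → u ∼ v
  ≗⇒∼ u≗v = 1# , (λ 1≡0 → 0≢1 (sym 1≡0)) , (λ i → trans (u≗v i) (sym (*-identityˡ _)))

  ∼-sym : ∀ {I : Set} {u v : I → Carrier} → u ∼ v → v ∼ u
  ∼-sym {u = u} {v} (c , c≢0 , u≡cv) with inverse c c≢0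
  ... | c⁻¹ , cc⁻¹≡1 = c⁻¹ , c⁻¹≢0 , v≡c⁻¹u
    where
    c⁻¹≢0 : ¬ c⁻¹ ≡ 0#
    c⁻¹≢0 c⁻¹≡0 = 0≢1 (trans (sym (zeroʳ c)) (trans (cong (c *_) (sym c⁻¹≡0)) cc⁻¹≡1))
    v≡c⁻¹u : ∀ i → v i ≡ c⁻¹ * u i
    v≡c⁻¹u i = begin
      v i              ≡⟨ sym (*-identityˡ (v i)) ⟩
      1# * v i         ≡⟨ cong (_* v i) (trans (sym cc⁻¹≡1) (*-comm c c⁻¹)) ⟩
      c⁻¹ * c * v i    ≡⟨ *-assoc c⁻¹ c (v i) ⟩
      c⁻¹ * (c * v i)  ≡⟨ cong (c⁻¹ *_) (sym (u≡cv i)) ⟩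
      c⁻¹ * u i        ∎

  ∼-trans : ∀ {I : Set} {u v w : I → Carrier} → u ∼ v → v ∼ w → u ∼ w
  ∼-trans (c , c≢0 , u≡cv) (d , d≢0 , v≡dw) =
    c * d , *-≢0 c≢0 d≢0 ,
    (λ i → trans (u≡cv i) (trans (cong (c *_) (v≡dw i)) (sym (*-assoc c d _))))

  module Linear {I : Set} (sumI : (I → Carrier) → Carrier)
                (sumI-cong : ∀ {g h} → g ≗ h → sumI g ≡ sumI h)
                (*-distribˡ-sumI : ∀ c g → c * sumI g ≡ sumI (λ i → c * g i)) where

    apply-cong : ∀ M {u v} → u ≗ v → apply sumI M u ≗ apply sumI M v
    apply-cong M u≗v i = sumI-cong (λ j → cong (M i j *_) (u≗v j))

    apply-scale : ∀ M c u → apply sumI M (λ j → c * u j) ≗ (λ i → c * apply sumI M u i)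
    apply-scale M c u i =
      trans (sumI-cong (λ j → x∙yz≈y∙xz (M i j) c (u j))) (sym (*-distribˡ-sumI c _))

    apply-zero : ∀ M {u} → (∀ j → u j ≡ 0#) → ∀ i → apply sumI M u i ≡ 0#
    apply-zero M {u} u≡0 i = begin
      apply sumI M u i                    ≡⟨ apply-cong M (λ j → trans (u≡0 j) (sym (zeroˡ (u j)))) i ⟩
      apply sumI M (λ j → 0# * u j) i     ≡⟨ apply-scale M 0# u i ⟩
      0# * apply sumI M u i               ≡⟨ zeroˡ _ ⟩
      0#                                  ∎

    apply-∼ : ∀ M {u v} → u ∼ v → apply sumI M u ∼ apply sumI M v
    apply-∼ M {v = v} (c , c≢0 , u≡cv) =
      c , c≢0 , (λ i → trans (apply-cong M u≡cv i) (apply-scale M c v i))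

    invertible⇒nonzero : ∀ {M u} → Invertible sumI M → Dec (Nonzero (apply sumI M u)) →
                         Nonzero u → Nonzero (apply sumI M u)
    invertible⇒nonzero _ (yes Mu≢0) _ = Mu≢0
    invertible⇒nonzero {u = u} (N , NM≡id , _) (no ¬Mu≢0) (j , uⱼ≢0) =
      ⊥-elim (uⱼ≢0 (trans (sym (NM≡id u j)) (apply-zero N (¬nonzero⇒zero ¬Mu≢0) j)))

    invertible⇒reflects-∼ : ∀ {M u v} → Invertible sumI M →
                            apply sumI M u ∼ apply sumI M v → u ∼ v
    invertible⇒reflects-∼ {u = u} {v} (N , NM≡id , _) Mu∼Mv =
      ∼-trans (≗⇒∼ (λ i → sym (NM≡id u i))) (∼-trans (apply-∼ N Mu∼Mv) (≗⇒∼ (NM≡id v)))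

  module LinearFin {m : ℕ} = Linear (sumFin {m}) sumFin-cong (*-distribˡ-sumFin {m})
  module LinearWords {t r : ℕ} = Linear (sumWords t r) (sumWords-cong t r) (*-distribˡ-sumWords t r)

  -- Cyclic codes

  last-column↦first : ∀ {I : Set} {m} (A : (I → Carrier) → I → Carrier)
                      (H : Fin (suc m) → I → Carrier) →
    (∀ {u v} → A u ∼ A v → u ∼ v) → (∀ i j → H i ∼ H j → i ≡ j) →
    (∀ i → H (suc i) ≗ A (H (inject₁ i))) →
    ∀ k → A (H (fromℕ m)) ∼ H k → k ≡ zero
  last-column↦first A H A-reflects-∼ H-injective H-next zero    _        = refl
  last-column↦first A H A-reflects-∼ H-injective H-next (suc k) AHₘ∼Hₖ₊₁ =
    ⊥-elim (Finₚ.fromℕ≢inject₁ (H-injective _ _ (A-reflects-∼ (∼-trans AHₘ∼Hₖ₊₁ (≗⇒∼ (H-next k))))))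

  shift-preserves-code : ∀ {q t r m} (H : Fin (suc m) → Vec (Fin r) t → Carrier)
    (M : Vec (Fin r) t → Vec (Fin r) t → Carrier) {β} → InFq q β →
    (∀ i → H (suc i) ≗ apply (sumWords t r) M (H (inject₁ i))) →
    (∀ f → apply (sumWords t r) M (H (fromℕ m)) f ≡ β * H zero f) →
    ∀ w → InCode q t r (suc m) H w → InCode q t r (suc m) H (shift β w)
  shift-preserves-code {q} {t} {r} {m} H M {β} β∈Fq H-next H-wrap w (w∈Fq , Hw≡0) =
    shift∈Fq , Hshift≡0
    where
    MH : Fin (suc m) → Vec (Fin r) t → Carrier
    MH i = apply (sumWords t r) M (H i)
    wₘ = w (fromℕ m)

    shift∈Fq : ∀ i → InFq q (shift β w i)
    shift∈Fq zero    = InFq-* {q} β∈Fq (w∈Fq (fromℕ m))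
    shift∈Fq (suc i) = w∈Fq (inject₁ i)

    Hshift≡0 : ∀ f → sumFin (λ i → shift β w i * H i f) ≡ 0#
    Hshift≡0 f = begin
      β * wₘ * H zero f + sumFin (λ i → w (inject₁ i) * H (suc i) f)
        ≡⟨ cong₂ _+_ (trans (xy∙z≈y∙xz β wₘ (H zero f)) (cong (wₘ *_) (sym (H-wrap f))))
                     (sumFin-cong {m} (λ i → cong (w (inject₁ i) *_) (H-next i f))) ⟩
      wₘ * MH (fromℕ m) f + sumFin (λ i → w (inject₁ i) * MH (inject₁ i) f)
        ≡⟨ +-comm _ _ ⟩
      sumFin (λ i → w (inject₁ i) * MH (inject₁ i) f) + wₘ * MH (fromℕ m) f
        ≡⟨ sym (sumFin-init-last (λ i → w i * MH i f)) ⟩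
      sumFin (λ i → w i * MH i f)
        ≡⟨ sym (apply-sumFin t r M w H f) ⟩
      apply (sumWords t r) M (λ g → sumFin (λ i → w i * H i g)) f
        ≡⟨ LinearWords.apply-zero M Hw≡0 f ⟩
      0# ∎

  ∼⇒scalar∈Fq : ∀ {q} {I : Set} {u v : I → Carrier} → Dec (Nonzero v) → u ∼ v →
                (∀ i → InFq q (u i)) → (∀ i → InFq q (v i)) →
                ∃ λ β → InFq q β × (∀ i → u i ≡ β * v i)
  ∼⇒scalar∈Fq {q} (yes (i , vᵢ≢0)) (c , _ , u≡cv) u∈Fq v∈Fq =
    c , InFq-ratio {q} (u≡cv i) vᵢ≢0 (u∈Fq i) (v∈Fq i) , u≡cv
  ∼⇒scalar∈Fq {q} {u = u} {v} (no ¬v≢0) (c , _ , u≡cv) _ _ = 1# , InFq-1 q , u≡1v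
    where
    u≡1v : ∀ i → u i ≡ 1# * v i
    u≡1v i = begin
      u i       ≡⟨ u≡cv i ⟩
      c * v i   ≡⟨ cong (c *_) (¬nonzero⇒zero ¬v≢0 i) ⟩
      c * 0#    ≡⟨ zeroʳ c ⟩
      0#        ≡⟨ sym (¬nonzero⇒zero ¬v≢0 i) ⟩
      v i       ≡⟨ sym (*-identityˡ (v i)) ⟩
      1# * v i  ∎

  module Subfield (q : ℕ) (^q-additive : ∀ x y → (x + y) ^ q ≡ x ^ q + y ^ q) where

    ^ᶠq-additive : ∀ x y → (x + y) ^ᶠ q ≡ x ^ᶠ q + y ^ᶠ q
    ^ᶠq-additive x y = begin
      (x + y) ^ᶠ q      ≡⟨ ^ᶠ≡^ (x + y) q ⟩
      (x + y) ^ q       ≡⟨ ^q-additive x y ⟩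
      x ^ q + y ^ q     ≡⟨ sym (cong₂ _+_ (^ᶠ≡^ x q) (^ᶠ≡^ y q)) ⟩
      x ^ᶠ q + y ^ᶠ q   ∎

    InFq-0 : InFq q 0#
    InFq-0 = identityʳ-unique (0# ^ᶠ q) (0# ^ᶠ q)
               (trans (sym (^ᶠq-additive 0# 0#)) (cong (_^ᶠ q) (+-identityʳ 0#)))

    InFq-+ : ∀ {x y} → InFq q x → InFq q y → InFq q (x + y)
    InFq-+ {x} {y} x∈Fq y∈Fq = trans (^ᶠq-additive x y) (cong₂ _+_ x∈Fq y∈Fq)

    InFq-sumFin : ∀ {m} {g : Fin m → Carrier} → (∀ i → InFq q (g i)) → InFq q (sumFin g)
    InFq-sumFin {zero}  _    = InFq-0
    InFq-sumFin {suc m} g∈Fq = InFq-+ (g∈Fq zero) (InFq-sumFin (λ i → g∈Fq (suc i)))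

    InFq-sumWords : ∀ t r {g : Vec (Fin r) t → Carrier} → (∀ f → InFq q (g f)) → InFq q (sumWords t r g)
    InFq-sumWords zero    r g∈Fq = g∈Fq []
    InFq-sumWords (suc t) r g∈Fq = InFq-sumFin (λ j → InFq-sumWords t r (λ f → g∈Fq (j ∷ f)))

    InFq-apply : ∀ {t r} {M : Vec (Fin r) t → Vec (Fin r) t → Carrier} {u} →
                 (∀ f g → InFq q (M f g)) → (∀ g → InFq q (u g)) →
                 ∀ f → InFq q (apply (sumWords t r) M u f)
    InFq-apply {t} {r} M∈Fq u∈Fq f = InFq-sumWords t r (λ g → InFq-* {q} (M∈Fq f g) (u∈Fq g))

    constacyclic : ∀ {t r n} (H : Fin n → Vec (Fin r) t → Carrier)
      (M : Vec (Fin r) t → Vec (Fin r) t → Carrier) →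
      (∀ i f → InFq q (H i f)) → (∀ f g → InFq q (M f g)) → Invertible (sumWords t r) M →
      (∀ i j → H i ∼ H j → i ≡ j) →
      (∀ (i j : Fin n) → toℕ j ≡ suc (toℕ i) → H j ≗ apply (sumWords t r) M (H i)) →
      (∀ i → ∃ λ k → apply (sumWords t r) M (H i) ∼ H k) →
      Constacyclic q n (InCode q t r n H)
    constacyclic {n = zero} _ _ _ _ _ _ _ _ = 1# , InFq-1 q , (λ _ w∈C → w∈C)
    constacyclic {t} {r} {suc m} H M H∈Fq M∈Fq M-invertible H-injective H-next M-permutes-columns =
      let β , β∈Fq , MHₘ≡βH₀ = ∼⇒scalar∈Fq {q} (nonzero?-Words t r (H zero)) MHₘ∼H₀
                                   (InFq-apply M∈Fq (H∈Fq (fromℕ m))) (H∈Fq zero)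
        in β , β∈Fq , shift-preserves-code {q} H M β∈Fq H-next′ MHₘ≡βH₀
      where
      H-next′ : ∀ i → H (suc i) ≗ apply (sumWords t r) M (H (inject₁ i))
      H-next′ i = H-next (inject₁ i) (suc i) (cong suc (sym (Finₚ.toℕ-inject₁ i)))
      MHₘ∼H₀ : apply (sumWords t r) M (H (fromℕ m)) ∼ H zero
      MHₘ∼H₀ with M-permutes-columns (fromℕ m)
      ... | k , MHₘ∼Hₖ = subst (λ k → apply (sumWords t r) M (H (fromℕ m)) ∼ H k) k≡0 MHₘ∼Hₖ
        where
        k≡0 : k ≡ zero
        k≡0 = last-column↦first _ H (LinearWords.invertible⇒reflects-∼ M-invertible)
                                H-injective H-next′ k MHₘ∼Hₖ

-- Imported only here: inside FieldProperties, _*_ and _^_ denote the field operations.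
open import Data.Nat using (_*_; _^_; _≤_)
open import Data.Product using (Σ)

mainTheorem9 :
    ∀ (p e q r t n : ℕ) →
    Prime p → 1 ≤ e → q ≡ p ^ e →
    2 ≤ r → 2 ≤ t → t < q →
    n * (q ^ t ∸ 1) ≡ q ^ (r * t) ∸ 1 →
    (F : FiniteField (q ^ t)) →
    let open FiniteField F
        open FF F
        sumV = sumWords t r
    in
    -- a Singer cycle generator ω of PG(r-1, q^t)
    (ω : Fin r → Fin r → Carrier) → SingerGenerator r n ω →
    -- a (linear) collineation M mapping Ω onto the canonical subgeometry
    (M : Vec (Fin r) t → Vec (Fin r) t → Carrier) → Invertible sumV M →
    (∀ y → InΩ q t r y → InCanonical q t r (apply sumV M y)) →
    -- ω̂ ∈ GL(r^t, q) inducing P^α ↦ (ωP)^α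
    (ω̂ : Vec (Fin r) t → Vec (Fin r) t → Carrier) →
    (∀ f g → InFq q (ω̂ f g)) → Invertible sumV ω̂ →
    (∀ (P : Fin r → Carrier) (v : Vec (Fin r) t → Carrier) →
       Nonzero P → (∀ f → InFq q (v f)) →
       v ∼ apply sumV M (alpha q t r P) →
       apply sumV ω̂ v ∼ apply sumV M (alpha q t r (apply sumFin ω P))) →
    -- columns H_0..H_{n-1}: coordinate vectors of the points of V_{r,t}, each once
    (H : Fin n → Vec (Fin r) t → Carrier) →
    (∀ i f → InFq q (H i f)) →
    (∀ i → Σ (Fin r → Carrier) λ P →
       Nonzero P × (H i ∼ apply sumV M (alpha q t r P))) →
    (∀ (P : Fin r → Carrier) → Nonzero P →
       Σ (Fin n) λ i → H i ∼ apply sumV M (alpha q t r P)) →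
    (∀ i j → H i ∼ H j → i ≡ j) →
    -- ordering H_{i+1} = ω̂ (H_i)
    (∀ (i j : Fin n) → toℕ j ≡ suc (toℕ i) →
       ∀ f → H j f ≡ apply sumV ω̂ (H i) f) →
    Constacyclic q n (InCode q t r n H)
mainTheorem9 p e q r t n p-prime _ q≡pᵉ _ _ _ _ F
             ω (ω-invertible , _) _ _ _ ω̂ ω̂∈Fq ω̂-invertible ω̂-maps-α
             H H∈Fq H-on-V V-on-H H-injective H-next =
  constacyclic H ω̂ H∈Fq ω̂∈Fq ω̂-invertible H-injective H-next ω̂-permutes-columns
  where
  open FiniteField F
  open FF F
  open FieldProperties F
  open Subfield q (frobenius-q {p} {e} {q} {t} p-prime q≡pᵉ refl)

  ω̂-permutes-columns : ∀ i → ∃ λ k → apply (sumWords t r) ω̂ (H i) ∼ H k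
  ω̂-permutes-columns i with H-on-V i
  ... | P , P≢0 , Hᵢ∼αP
    with V-on-H (apply sumFin ω P) (LinearFin.invertible⇒nonzero ω-invertible (nonzero?-Fin _) P≢0)
  ...   | k , Hₖ∼αωP = k , ∼-trans (ω̂-maps-α P (H i) P≢0 (H∈Fq i) Hᵢ∼αP) (∼-sym Hₖ∼αωP)
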